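{- Fix integers $m\ge 1$ and $n_1,\dots,n_m\ge 1$. Consider all $\oplus$-BA Flowers with $m$ petals of sizes $(n_1,\dots,n_m)$ (i.e. all choices of signs of the literals). These networks form exactly one behavioural isomorphism class if $m$ is even, and exactly two behavioural isomorphism classes if $m$ is odd.
   Context: A BAN on automata $V=\{1,\dots,n\}$ is a family of functions $f_i:\{0,1\}^n\to\{0,1\}$. A $\oplus$-BA Flower with $m$ petals of sizes $(n_1,\dots,n_m)$ consists of $m$ directed cycles $\mathcal{C}_k=(i^k_1,\dots,i^k_{n_k})$, $k=1,\dots,m$, which pairwise share only the central automaton $o=i^1_1=\dots=i^m_1$ (all other automata are distinct), so $n=1+\sum_k(n_k-1)$. For $j\ge 2$, $f_{i^k_j}(x)=\sigma_{k,j}(x_{i^k_{j-1}})$, and $f_o(x)=\bigoplus_{k=1}^m \sigma_k(x_{i^k_{n_k}})$ (where $i^k_{n_k}=o$ if $n_k=1$), each $\sigma$ being identity or negation. For $W\subseteq V$, $F_W(x)$ is the configuration with $F_W(x)_i=f_i(x)$ for $i\in W$ and $F_W(x)_i=x_i$ otherwise. Two BANs $\mathcal{N},\mathcal{N}'$ on $n$ automata are behaviourally isomorphic if there exist bijections $\varphi:V\to V'$ and $\phi:\{0,1\}^n\to\{0,1\}^n$ such that $\phi(F_W(x))=F'_{\varphi(W)}(\phi(x))$ for every $W\subseteq V$ and every configuration $x$. -}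

module Defs where

open import Data.Nat using (ℕ; zero; suc; _∸_)
open import Data.Bool using (Bool; true; false; not; _xor_; if_then_else_)
open import Data.Fin using (Fin; zero; suc; fromℕ; inject₁; _↑ˡ_; _↑ʳ_; splitAt)
open import Data.Vec using (Vec; []; _∷_; lookup; tabulate; map; sum)
open import Data.Sum using (_⊎_; inj₁; inj₂)
open import Data.Product using (Σ; _,_; ∃; ∃-syntax; _×_)
open import Function.Bundles using (_↔_; Inverse)
open import Relation.Binary.PropositionalEquality using (_≡_)

Config : ℕ → Set
Config n = Vec Bool n

BAN : ℕ → Set
BAN n = Fin n → Config n → Bool

-- Subsets W ⊆ V as characteristic vectors.
Subset : ℕ → Set
Subset n = Vec Bool n

update : ∀ {n} → BAN n → Subset n → Config n → Config n
update f W x = tabulate (λ i → if lookup W i then f i x else lookup x i)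

image : ∀ {n} → (Fin n ↔ Fin n) → Subset n → Subset n
image φ W = tabulate (λ j → lookup W (Inverse.from φ j))

BehIso : ∀ {n} → BAN n → BAN n → Set
BehIso {n} f g =
  Σ (Fin n ↔ Fin n) λ φ → Σ (Config n ↔ Config n) λ ψ →
    ∀ (W : Subset n) (x : Config n) →
      Inverse.to ψ (update f W x) ≡ update g (image φ W) (Inverse.to ψ x)

-- Petal sizes ns = (n_1,…,n_m), each n_k ≥ 1.  Petal k has n_k ∸ 1
-- non-central automata i^k_2,…,i^k_{n_k}.  Canonical labelling of
-- V = Fin (1 + Σ_k (n_k ∸ 1)): index 0 is the centre o, followed by
-- the non-central automata of petal 1 in order, then petal 2, etc.

petalLens : ∀ {m} → Vec ℕ m → Vec ℕ m
petalLens ns = map (_∸ 1) ns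

flowerSize : ∀ {m} → Vec ℕ m → ℕ
flowerSize ns = suc (sum (petalLens ns))

-- position j (0-based, i.e. automaton i^k_{j+2}) of petal k  ↦  index
-- among all non-central automata
petalIndex : ∀ {m} (ls : Vec ℕ m) (k : Fin m) → Fin (lookup ls k) → Fin (sum ls)
petalIndex (l ∷ ls) zero    j = j ↑ˡ sum ls
petalIndex (l ∷ ls) (suc k) j = l ↑ʳ petalIndex ls k j

petalDecode : ∀ {m} (ls : Vec ℕ m) → Fin (sum ls) → Σ (Fin m) (λ k → Fin (lookup ls k))
petalDecode (l ∷ ls) p with splitAt l p
... | inj₁ j = zero , j
... | inj₂ q with petalDecode ls q
...   | k , j = suc k , j

-- Literal with sign s (true = negation, false = identity).
lit : Bool → Bool → Bool
lit s b = s xor b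

-- Predecessor on a petal with l non-central automata, given the centre
-- and the embedding of the petal's automata: predecessor of i^k_2 is o,
-- predecessor of i^k_{j+1} is i^k_j.
prevOnPetal : ∀ {N} (l : ℕ) → Fin N → (Fin l → Fin N) → Fin l → Fin N
prevOnPetal (suc l) o g zero    = o
prevOnPetal (suc l) o g (suc j) = g (inject₁ j)

-- Last automaton i^k_{n_k} of a petal (the centre if n_k = 1).
lastOnPetal : ∀ {N} (l : ℕ) → Fin N → (Fin l → Fin N) → Fin N
lastOnPetal zero    o g = o
lastOnPetal (suc l) o g = g (fromℕ l)

record FlowerSigns {m : ℕ} (ns : Vec ℕ m) : Set where
  field
    centreSign : Fin m → Bool
    petalSign  : (k : Fin m) → Fin (lookup (petalLens ns) k) → Bool
open FlowerSigns public

bigXor : ∀ {m} → (Fin m → Bool) → Bool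
bigXor {zero}  h = false
bigXor {suc m} h = h zero xor bigXor (λ k → h (suc k))

flower : ∀ {m} (ns : Vec ℕ m) → FlowerSigns ns → BAN (flowerSize ns)
flower {m} ns σ zero x =
  bigXor (λ k → lit (centreSign σ k)
    (lookup x (lastOnPetal (lookup ls k) zero (λ j → suc (petalIndex ls k j)))))
  where ls = petalLens ns
flower {m} ns σ (suc p) x with petalDecode (petalLens ns) p
... | k , j = lit (petalSign σ k j)
    (lookup x (prevOnPetal (lookup ls k) zero (λ j' → suc (petalIndex ls k j')) j))
  where ls = petalLens ns

module Submission where

-- Proof idea.  A flower is determined by its signs, and two flowers are
-- compared through one invariant, the parity of all their signs
--   parity σ = ⊕_k σ_k ⊕ ⊕_{k,j} σ_{k,j}.
--
-- If a mask c satisfies g_i(x ⊕ c) = f_i(x) ⊕ c_i, then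
--   x ↦ x ⊕ c (with the identity on automata) is a behavioural isomorphism
--   from f to g.  For flowers σ, τ a mask with value b at the centre is
--   propagated along every petal by the sign differences σ_{k,j} ⊕ τ_{k,j};
--   the only remaining condition, at the centre, reads
--     parity τ ⊕ (m copies of b) = parity σ ⊕ b.
--   For even m take b = parity σ ⊕ parity τ; for odd m take b = false
--   whenever the parities agree.
-- * Invariant.  Behavioural isomorphisms map fixed points to fixed points
--   (update everything at once).  Telescoping along the petals shows that for
--   odd m a flower with a fixed point has parity false; the positive flower
--   (all literals are identities) fixes 0, while negating one centre literal
--   makes the parity true.

open import Defs
open import Data.Nat using (ℕ; zero; suc; _≤_; _%_)
open import Data.Bool using (Bool; true; false; _xor_; if_then_else_)
open import Data.Bool.Properties
  using (xor-assoc; xor-comm; xor-same; xor-identityʳ; xor-∧-commutativeRing)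
open import Data.Fin using (Fin; zero; suc; fromℕ; inject₁; splitAt)
open import Data.Fin.Properties using (splitAt-↑ˡ; splitAt-↑ʳ; splitAt⁻¹-↑ˡ; splitAt⁻¹-↑ʳ)
open import Data.Vec using (Vec; _∷_; lookup; tabulate; replicate; sum)
open import Data.Vec.Properties using (lookup∘tabulate; tabulate∘lookup; tabulate-cong; lookup-replicate)
open import Data.Vec.Relation.Unary.All using (All)
open import Data.Product using (_×_; Σ; _,_; uncurry)
open import Data.Sum using (_⊎_; inj₁; inj₂)
open import Function using (_∘_)
open import Function.Bundles using (_↔_; Inverse; mk↔ₛ′)
open import Function.Construct.Identity using (↔-id)
open import Relation.Nullary using (¬_)
open import Relation.Binary.PropositionalEquality
  using (_≡_; refl; sym; trans; cong; cong₂; subst; module ≡-Reasoning)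
open import Algebra.Bundles using (CommutativeRing)
open import Algebra.Properties.CommutativeSemigroup
  (CommutativeRing.+-commutativeSemigroup xor-∧-commutativeRing)
  using (interchange; x∙yz≈y∙xz; x∙yz≈xz∙y; xy∙z≈y∙xz; xy∙z≈xz∙y)

open ≡-Reasoning

xor-cancelˡ : ∀ x y → x xor (x xor y) ≡ y
xor-cancelˡ x y = trans (sym (xor-assoc x x y)) (cong (_xor y) (xor-same x))

xor-fixed : ∀ p x → x ≡ p xor x → p ≡ false
xor-fixed false x _ = refl
xor-fixed true false ()
xor-fixed true true ()

-- The local identity behind switching one arc: if the mask changes by s ⊕ t
-- across an arc, an input x read with sign t after masking equals the input
-- read with sign s before masking, plus the mask.
switch-arc : ∀ s t x c → t xor (x xor c) ≡ (s xor x) xor ((s xor t) xor c)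
switch-arc s t x c = sym (begin
  (s xor x) xor ((s xor t) xor c) ≡⟨ cong ((s xor x) xor_) (xor-assoc s t c) ⟩
  (s xor x) xor (s xor (t xor c)) ≡⟨ interchange s x s (t xor c) ⟩
  (s xor s) xor (x xor (t xor c)) ≡⟨ cong (_xor (x xor (t xor c))) (xor-same s) ⟩
  x xor (t xor c)                 ≡⟨ x∙yz≈y∙xz x t c ⟩
  t xor (x xor c)                 ∎)

bigXor-cong : ∀ {m} {a b : Fin m → Bool} → (∀ k → a k ≡ b k) → bigXor a ≡ bigXor b
bigXor-cong {zero} h = refl
bigXor-cong {suc m} h = cong₂ _xor_ (h zero) (bigXor-cong (h ∘ suc))

bigXor-xor : ∀ {m} (a b : Fin m → Bool) → bigXor (λ k → a k xor b k) ≡ bigXor a xor bigXor b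
bigXor-xor {zero} a b = refl
bigXor-xor {suc m} a b = trans (cong ((a zero xor b zero) xor_) (bigXor-xor (a ∘ suc) (b ∘ suc)))
                               (interchange (a zero) (b zero) _ _)

bigXor-false : ∀ m → bigXor {m} (λ _ → false) ≡ false
bigXor-false zero = refl
bigXor-false (suc m) = bigXor-false m

bigXor-const-even : ∀ m b → m % 2 ≡ 0 → bigXor {m} (λ _ → b) ≡ false
bigXor-const-even zero b _ = refl
bigXor-const-even (suc (suc m)) b even = begin
  b xor (b xor bigXor {m} (λ _ → b)) ≡⟨ xor-cancelˡ b _ ⟩
  bigXor {m} (λ _ → b)               ≡⟨ bigXor-const-even m b even ⟩
  false                               ∎

bigXor-const-odd : ∀ m b → m % 2 ≡ 1 → bigXor {m} (λ _ → b) ≡ b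
bigXor-const-odd (suc zero) b _ = xor-identityʳ b
bigXor-const-odd (suc (suc m)) b odd = begin
  b xor (b xor bigXor {m} (λ _ → b)) ≡⟨ xor-cancelˡ b _ ⟩
  bigXor {m} (λ _ → b)               ≡⟨ bigXor-const-odd m b odd ⟩
  b                                   ∎

vec-ext : ∀ {A : Set} {n} {xs ys : Vec A n} → (∀ i → lookup xs i ≡ lookup ys i) → xs ≡ ys
vec-ext {xs = xs} {ys} h = trans (sym (tabulate∘lookup xs)) (trans (tabulate-cong h) (tabulate∘lookup ys))

lookup-update : ∀ {n} (f : BAN n) W x (i : Fin n) →
  lookup (update f W x) i ≡ (if lookup W i then f i x else lookup x i)
lookup-update f W x i = lookup∘tabulate _ i

_⊕_ : ∀ {n} → Config n → (Fin n → Bool) → Config n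
x ⊕ c = tabulate (λ i → lookup x i xor c i)

lookup-⊕ : ∀ {n} (x : Config n) c i → lookup (x ⊕ c) i ≡ lookup x i xor c i
lookup-⊕ x c i = lookup∘tabulate _ i

⊕-involutive : ∀ {n} (x : Config n) c → (x ⊕ c) ⊕ c ≡ x
⊕-involutive x c = vec-ext λ i → begin
  lookup ((x ⊕ c) ⊕ c) i       ≡⟨ lookup-⊕ (x ⊕ c) c i ⟩
  lookup (x ⊕ c) i xor c i     ≡⟨ cong (_xor c i) (lookup-⊕ x c i) ⟩
  (lookup x i xor c i) xor c i ≡⟨ xor-assoc (lookup x i) (c i) (c i) ⟩
  lookup x i xor (c i xor c i) ≡⟨ cong (lookup x i xor_) (xor-same (c i)) ⟩
  lookup x i xor false         ≡⟨ xor-identityʳ _ ⟩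
  lookup x i                   ∎

switching : ∀ {n} (f g : BAN n) (c : Fin n → Bool) →
  (∀ i x → g i (x ⊕ c) ≡ f i x xor c i) → BehIso f g
switching {n} f g c conj = ↔-id (Fin n) , translation , commutes
  where
  translation : Config n ↔ Config n
  translation = mk↔ₛ′ (_⊕ c) (_⊕ c) (λ y → ⊕-involutive y c) (λ y → ⊕-involutive y c)

  entry : ∀ x i w → (if w then f i x else lookup x i) xor c i
                  ≡ (if w then g i (x ⊕ c) else lookup (x ⊕ c) i)
  entry x i true = sym (conj i x)
  entry x i false = sym (lookup-⊕ x c i)

  commutes : ∀ W x → update f W x ⊕ c ≡ update g (image (↔-id (Fin n)) W) (x ⊕ c)
  commutes W x rewrite tabulate∘lookup W = vec-ext λ i → begin
    lookup (update f W x ⊕ c) i   ≡⟨ lookup-⊕ (update f W x) c i ⟩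
    lookup (update f W x) i xor c i ≡⟨ cong (_xor c i) (lookup-update f W x i) ⟩
    (if lookup W i then f i x else lookup x i) xor c i
                                    ≡⟨ entry x i (lookup W i) ⟩
    (if lookup W i then g i (x ⊕ c) else lookup (x ⊕ c) i)
                                    ≡⟨ lookup-update g W (x ⊕ c) i ⟨
    lookup (update g W (x ⊕ c)) i   ∎

-- Fixed points, and their preservation by behavioural isomorphisms:
-- a fixed point is a configuration left unchanged by updating every automaton.
FixedPoint : ∀ {n} → BAN n → Config n → Set
FixedPoint f x = ∀ i → f i x ≡ lookup x i

everything : ∀ {n} → Subset n
everything = replicate _ true

lookup-update-everything : ∀ {n} (f : BAN n) x i → lookup (update f everything x) i ≡ f i x
lookup-update-everything f x i =
  trans (lookup-update f everything x i) (cong (if_then f i x else lookup x i) (lookup-replicate i true))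

image-everything : ∀ {n} (φ : Fin n ↔ Fin n) → image φ everything ≡ everything
image-everything φ = vec-ext λ i →
  trans (lookup∘tabulate _ i) (trans (lookup-replicate (Inverse.from φ i) true) (sym (lookup-replicate i true)))

fixedPoint-transport : ∀ {n} {f g : BAN n} {x} → BehIso f g →
  FixedPoint f x → Σ (Config n) (FixedPoint g)
fixedPoint-transport {n} {f} {g} {x} (φ , ψ , commutes) fixed = Inverse.to ψ x , λ i → begin
  g i y                             ≡⟨ lookup-update-everything g y i ⟨
  lookup (update g everything y) i  ≡⟨ cong (λ W → lookup (update g W y) i) (image-everything φ) ⟨
  lookup (update g (image φ everything) y) i ≡⟨ cong (λ v → lookup v i) (commutes everything x) ⟨
  lookup (Inverse.to ψ (update f everything x)) i ≡⟨ cong (λ v → lookup (Inverse.to ψ v) i) stable ⟩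
  lookup y i                        ∎
  where
  y : Config n
  y = Inverse.to ψ x
  stable : update f everything x ≡ x
  stable = vec-ext λ j → trans (lookup-update-everything f x j) (fixed j)

prefixXor : ∀ {l} → (Fin l → Bool) → Fin l → Bool
prefixXor s zero = s zero
prefixXor s (suc j) = s zero xor prefixXor (s ∘ suc) j

prefixXor-step : ∀ {l} (s : Fin (suc l) → Bool) (j : Fin l) →
  prefixXor s (suc j) ≡ s (suc j) xor prefixXor s (inject₁ j)
prefixXor-step s zero = xor-comm (s zero) (s (suc zero))
prefixXor-step s (suc j) = begin
  s zero xor prefixXor (s ∘ suc) (suc j)
    ≡⟨ cong (s zero xor_) (prefixXor-step (s ∘ suc) j) ⟩
  s zero xor (s (suc (suc j)) xor prefixXor (s ∘ suc) (inject₁ j))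
    ≡⟨ x∙yz≈y∙xz (s zero) (s (suc (suc j))) _ ⟩
  s (suc (suc j)) xor prefixXor s (suc (inject₁ j)) ∎

prefixXor-inject₁ : ∀ {l} (s : Fin (suc l) → Bool) (j : Fin l) →
  prefixXor (s ∘ inject₁) j ≡ prefixXor s (inject₁ j)
prefixXor-inject₁ s zero = refl
prefixXor-inject₁ s (suc j) = cong (s zero xor_) (prefixXor-inject₁ (s ∘ suc) j)

prefixXor-last : ∀ {l} (s : Fin (suc l) → Bool) → prefixXor s (fromℕ l) ≡ bigXor s
prefixXor-last {zero} s = sym (xor-identityʳ (s zero))
prefixXor-last {suc l} s = cong (s zero xor_) (prefixXor-last (s ∘ suc))

Propagates : ∀ {N} l → Fin N → (Fin l → Fin N) → (Fin N → Bool) → (Fin l → Bool) → Set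
Propagates l o G h s = ∀ j → h (G j) ≡ s j xor h (prevOnPetal l o G j)

prevOnPetal-inject₁ : ∀ {N} l (o : Fin N) (G : Fin (suc l) → Fin N) (j : Fin l) →
  prevOnPetal (suc l) o G (inject₁ j) ≡ prevOnPetal l o (G ∘ inject₁) j
prevOnPetal-inject₁ (suc l) o G zero = refl
prevOnPetal-inject₁ (suc l) o G (suc j) = refl

prefix⇒propagates : ∀ {N} l (o : Fin N) G h (s : Fin l → Bool) →
  (∀ j → h (G j) ≡ prefixXor s j xor h o) → Propagates l o G h s
prefix⇒propagates (suc l) o G h s given zero = given zero
prefix⇒propagates (suc l) o G h s given (suc j) = begin
  h (G (suc j))                                        ≡⟨ given (suc j) ⟩
  prefixXor s (suc j) xor h o                          ≡⟨ cong (_xor h o) (prefixXor-step s j) ⟩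
  (s (suc j) xor prefixXor s (inject₁ j)) xor h o      ≡⟨ xor-assoc (s (suc j)) _ _ ⟩
  s (suc j) xor (prefixXor s (inject₁ j) xor h o)      ≡⟨ cong (s (suc j) xor_) (given (inject₁ j)) ⟨
  s (suc j) xor h (G (inject₁ j))                      ∎

propagates⇒prefix : ∀ {N} l (o : Fin N) G h (s : Fin l → Bool) →
  Propagates l o G h s → ∀ j → h (G j) ≡ prefixXor s j xor h o
propagates⇒prefix (suc l) o G h s prop zero = prop zero
propagates⇒prefix (suc l) o G h s prop (suc j) = begin
  h (G (suc j))                                        ≡⟨ prop (suc j) ⟩
  s (suc j) xor h (G (inject₁ j))                      ≡⟨ cong (s (suc j) xor_) earlier ⟩
  s (suc j) xor (prefixXor s (inject₁ j) xor h o)      ≡⟨ xor-assoc (s (suc j)) _ _ ⟨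
  (s (suc j) xor prefixXor s (inject₁ j)) xor h o      ≡⟨ cong (_xor h o) (prefixXor-step s j) ⟨
  prefixXor s (suc j) xor h o                          ∎
  where
  shortened : Propagates l o (G ∘ inject₁) h (s ∘ inject₁)
  shortened j' = trans (prop (inject₁ j')) (cong (λ p → s (inject₁ j') xor h p) (prevOnPetal-inject₁ l o G j'))
  earlier : h (G (inject₁ j)) ≡ prefixXor s (inject₁ j) xor h o
  earlier = trans (propagates⇒prefix l o (G ∘ inject₁) h (s ∘ inject₁) shortened j)
                  (cong (_xor h o) (prefixXor-inject₁ s j))

propagates-last : ∀ {N} l (o : Fin N) G h (s : Fin l → Bool) →
  Propagates l o G h s → h (lastOnPetal l o G) ≡ bigXor s xor h o
propagates-last zero o G h s prop = refl
propagates-last (suc l) o G h s prop =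
  trans (propagates⇒prefix (suc l) o G h s prop (fromℕ l)) (cong (_xor h o) (prefixXor-last s))

petalDecode-petalIndex : ∀ {m} (ls : Vec ℕ m) k j → petalDecode ls (petalIndex ls k j) ≡ (k , j)
petalDecode-petalIndex (l ∷ ls) zero j rewrite splitAt-↑ˡ l j (sum ls) = refl
petalDecode-petalIndex (l ∷ ls) (suc k) j
  rewrite splitAt-↑ʳ l (sum ls) (petalIndex ls k j) | petalDecode-petalIndex ls k j = refl

data PetalPosition {m} (ls : Vec ℕ m) : Fin (sum ls) → Set where
  at : ∀ k j → PetalPosition ls (petalIndex ls k j)

petalPosition : ∀ {m} (ls : Vec ℕ m) p → PetalPosition ls p
petalPosition (l ∷ ls) p with splitAt l p in split
... | inj₁ j = subst (PetalPosition (l ∷ ls)) (splitAt⁻¹-↑ˡ split) (at zero j)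
... | inj₂ q with petalPosition ls q
...   | at k j = subst (PetalPosition (l ∷ ls)) (splitAt⁻¹-↑ʳ split) (at (suc k) j)

module Flower {m} (ns : Vec ℕ m) where

  ls : Vec ℕ m
  ls = petalLens ns

  N : ℕ
  N = flowerSize ns

  petalNode : (k : Fin m) → Fin (lookup ls k) → Fin N
  petalNode k j = suc (petalIndex ls k j)

  predecessor : (k : Fin m) → Fin (lookup ls k) → Fin N
  predecessor k = prevOnPetal (lookup ls k) zero (petalNode k)

  lastNode : Fin m → Fin N
  lastNode k = lastOnPetal (lookup ls k) zero (petalNode k)

  data Automaton : Fin N → Set where
    centre : Automaton zero
    petal  : ∀ k j → Automaton (petalNode k j)

  automaton : ∀ i → Automaton i
  automaton zero = centre
  automaton (suc p) with petalPosition ls p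
  ... | at k j = petal k j

  PetalValues : Set
  PetalValues = (k : Fin m) → Fin (lookup ls k) → Bool

  onFlower : Bool → PetalValues → Fin N → Bool
  onFlower b g zero = b
  onFlower b g (suc p) = uncurry g (petalDecode ls p)

  onFlower-petal : ∀ b g k j → onFlower b g (petalNode k j) ≡ g k j
  onFlower-petal b g k j = cong (uncurry g) (petalDecode-petalIndex ls k j)

  flower-petal : ∀ σ k j x → flower ns σ (petalNode k j) x ≡ petalSign σ k j xor lookup x (predecessor k j)
  flower-petal σ k j x rewrite petalDecode-petalIndex ls k j = refl

  FlowerPropagates : (Fin N → Bool) → PetalValues → Set
  FlowerPropagates h s = ∀ k → Propagates (lookup ls k) zero (petalNode k) h (s k)

  centre-collect : ∀ (a : Fin m → Bool) {h s} → FlowerPropagates h s →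
    bigXor (λ k → a k xor h (lastNode k))
      ≡ (bigXor a xor bigXor (λ k → bigXor (s k))) xor bigXor {m} (λ _ → h zero)
  centre-collect a {h} {s} prop = begin
    bigXor (λ k → a k xor h (lastNode k))
      ≡⟨ bigXor-cong (λ k → trans (cong (a k xor_) (propagates-last _ zero (petalNode k) h (s k) (prop k)))
                                  (sym (xor-assoc (a k) _ _))) ⟩
    bigXor (λ k → (a k xor bigXor (s k)) xor h zero)
      ≡⟨ bigXor-xor (λ k → a k xor bigXor (s k)) (λ _ → h zero) ⟩
    bigXor (λ k → a k xor bigXor (s k)) xor bigXor {m} (λ _ → h zero)
      ≡⟨ cong (_xor bigXor {m} (λ _ → h zero)) (bigXor-xor a _) ⟩
    (bigXor a xor bigXor (λ k → bigXor (s k))) xor bigXor {m} (λ _ → h zero) ∎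

  parity : FlowerSigns ns → Bool
  parity σ = bigXor (centreSign σ) xor bigXor (λ k → bigXor (petalSign σ k))

  flower-switching : (σ τ : FlowerSigns ns) (c : Fin N → Bool) →
    FlowerPropagates c (λ k j → petalSign σ k j xor petalSign τ k j) →
    bigXor (λ k → centreSign τ k xor c (lastNode k)) ≡ bigXor (centreSign σ) xor c zero →
    BehIso (flower ns σ) (flower ns τ)
  flower-switching σ τ c prop centreEq = switching (flower ns σ) (flower ns τ) c conj
    where
    conj : ∀ i x → flower ns τ i (x ⊕ c) ≡ flower ns σ i x xor c i
    conj i x with automaton i
    ... | centre = begin
      bigXor (λ k → centreSign τ k xor lookup (x ⊕ c) (lastNode k))
        ≡⟨ bigXor-cong (λ k → trans (cong (centreSign τ k xor_) (lookup-⊕ x c (lastNode k)))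
                                    (x∙yz≈xz∙y (centreSign τ k) _ _)) ⟩
      bigXor (λ k → (centreSign τ k xor c (lastNode k)) xor X k)
        ≡⟨ bigXor-xor _ X ⟩
      bigXor (λ k → centreSign τ k xor c (lastNode k)) xor bigXor X
        ≡⟨ cong (_xor bigXor X) centreEq ⟩
      (bigXor (centreSign σ) xor c zero) xor bigXor X
        ≡⟨ xy∙z≈xz∙y (bigXor (centreSign σ)) (c zero) (bigXor X) ⟩
      (bigXor (centreSign σ) xor bigXor X) xor c zero
        ≡⟨ cong (_xor c zero) (bigXor-xor (centreSign σ) X) ⟨
      flower ns σ zero x xor c zero ∎
      where
      X : Fin m → Bool
      X k = lookup x (lastNode k)
    ... | petal k j = begin
      flower ns τ (petalNode k j) (x ⊕ c)        ≡⟨ flower-petal τ k j (x ⊕ c) ⟩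
      t xor lookup (x ⊕ c) P                      ≡⟨ cong (t xor_) (lookup-⊕ x c P) ⟩
      t xor (lookup x P xor c P)                  ≡⟨ switch-arc s t (lookup x P) (c P) ⟩
      (s xor lookup x P) xor ((s xor t) xor c P)  ≡⟨ cong₂ _xor_ (flower-petal σ k j x) (prop k j) ⟨
      flower ns σ (petalNode k j) x xor c (petalNode k j) ∎
      where
      s t : Bool
      s = petalSign σ k j
      t = petalSign τ k j
      P : Fin N
      P = predecessor k j

  -- Choosing the mask b at the centre and propagating the sign differences
  -- reduces the criterion to one equation between parities.
  parity-switching : (σ τ : FlowerSigns ns) (b : Bool) →
    parity τ xor bigXor {m} (λ _ → b) ≡ parity σ xor b → BehIso (flower ns σ) (flower ns τ)
  parity-switching σ τ b balanced = flower-switching σ τ c propagates centreEq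
    where
    d : PetalValues
    d k j = petalSign σ k j xor petalSign τ k j
    onPetals : PetalValues
    onPetals k j = prefixXor (d k) j xor b
    c : Fin N → Bool
    c = onFlower b onPetals
    propagates : FlowerPropagates c d
    propagates k = prefix⇒propagates _ zero (petalNode k) c (d k) (onFlower-petal b onPetals k)
    S T Pσ Pτ mb : Bool
    S = bigXor (centreSign σ)
    T = bigXor (centreSign τ)
    Pσ = bigXor (λ k → bigXor (petalSign σ k))
    Pτ = bigXor (λ k → bigXor (petalSign τ k))
    mb = bigXor {m} (λ _ → b)
    differences : bigXor (λ k → bigXor (d k)) ≡ Pσ xor Pτ
    differences = trans (bigXor-cong (λ k → bigXor-xor (petalSign σ k) (petalSign τ k)))
                        (bigXor-xor (λ k → bigXor (petalSign σ k)) (λ k → bigXor (petalSign τ k)))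
    centreEq : bigXor (λ k → centreSign τ k xor c (lastNode k)) ≡ S xor b
    centreEq = begin
      bigXor (λ k → centreSign τ k xor c (lastNode k)) ≡⟨ centre-collect (centreSign τ) {c} {d} propagates ⟩
      (T xor bigXor (λ k → bigXor (d k))) xor mb       ≡⟨ cong (λ z → (T xor z) xor mb) differences ⟩
      (T xor (Pσ xor Pτ)) xor mb  ≡⟨ cong (_xor mb) (x∙yz≈y∙xz T Pσ Pτ) ⟩
      (Pσ xor (T xor Pτ)) xor mb  ≡⟨ xor-assoc Pσ _ mb ⟩
      Pσ xor ((T xor Pτ) xor mb)  ≡⟨ cong (Pσ xor_) balanced ⟩
      Pσ xor ((S xor Pσ) xor b)   ≡⟨ cong (Pσ xor_) (xy∙z≈y∙xz S Pσ b) ⟩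
      Pσ xor (Pσ xor (S xor b))   ≡⟨ xor-cancelˡ Pσ _ ⟩
      S xor b                     ∎

  same-parity-iso : (σ τ : FlowerSigns ns) → parity σ ≡ parity τ → BehIso (flower ns σ) (flower ns τ)
  same-parity-iso σ τ eq = parity-switching σ τ false
    (trans (cong (parity τ xor_) (bigXor-false m)) (cong (_xor false) (sym eq)))

  even-iso : m % 2 ≡ 0 → (σ τ : FlowerSigns ns) → BehIso (flower ns σ) (flower ns τ)
  even-iso even σ τ = parity-switching σ τ (parity σ xor parity τ) (begin
    parity τ xor bigXor {m} (λ _ → parity σ xor parity τ) ≡⟨ cong (parity τ xor_) (bigXor-const-even m _ even) ⟩
    parity τ xor false                                   ≡⟨ xor-identityʳ (parity τ) ⟩
    parity τ                                             ≡⟨ xor-cancelˡ (parity σ) (parity τ) ⟨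
    parity σ xor (parity σ xor parity τ)                 ∎)

  parity-dichotomy : ∀ σ₁ σ₂ → parity σ₁ ≡ false → parity σ₂ ≡ true → (τ : FlowerSigns ns) →
    BehIso (flower ns τ) (flower ns σ₁) ⊎ BehIso (flower ns τ) (flower ns σ₂)
  parity-dichotomy σ₁ σ₂ p₁ p₂ τ with parity τ in eq
  ... | false = inj₁ (same-parity-iso τ σ₁ (trans eq (sym p₁)))
  ... | true  = inj₂ (same-parity-iso τ σ₂ (trans eq (sym p₂)))

  -- With an odd number of petals, a flower with a fixed point has parity 0:
  -- along each petal the fixed point propagates the petal signs, so the
  -- centre value y₀ satisfies y₀ = parity σ ⊕ y₀.
  fixedPoint-parity : m % 2 ≡ 1 → ∀ σ {y} → FixedPoint (flower ns σ) y → parity σ ≡ false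
  fixedPoint-parity odd σ {y} fixed = xor-fixed (parity σ) (lookup y zero) (begin
    lookup y zero                                            ≡⟨ fixed zero ⟨
    bigXor (λ k → centreSign σ k xor lookup y (lastNode k))  ≡⟨ centre-collect (centreSign σ) {lookup y} {petalSign σ} propagates ⟩
    parity σ xor bigXor {m} (λ _ → lookup y zero)            ≡⟨ cong (parity σ xor_) (bigXor-const-odd m _ odd) ⟩
    parity σ xor lookup y zero                               ∎)
    where
    propagates : FlowerPropagates (lookup y) (petalSign σ)
    propagates k j = trans (sym (fixed (petalNode k j))) (flower-petal σ k j y)

  positiveSigns : FlowerSigns ns
  positiveSigns = record { centreSign = λ _ → false ; petalSign = λ _ _ → false }

  positive-petals : bigXor (λ k → bigXor {lookup ls k} (λ _ → false)) ≡ false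
  positive-petals = trans (bigXor-cong (λ k → bigXor-false (lookup ls k))) (bigXor-false m)

  positive-parity : parity positiveSigns ≡ false
  positive-parity = cong₂ _xor_ (bigXor-false m) positive-petals

  positive-fixedPoint : FixedPoint (flower ns positiveSigns) (replicate N false)
  positive-fixedPoint i with automaton i
  ... | centre = trans (bigXor-cong (λ k → lookup-replicate (lastNode k) false)) (bigXor-false m)
  ... | petal k j = trans (flower-petal positiveSigns k j (replicate N false))
      (trans (lookup-replicate (predecessor k j) false) (sym (lookup-replicate (petalNode k j) false)))

  odd-parity-invariant : m % 2 ≡ 1 → ∀ τ → parity τ ≡ true → ¬ BehIso (flower ns positiveSigns) (flower ns τ)
  odd-parity-invariant odd τ odd-parity iso
    with _ , fixed ← fixedPoint-transport {f = flower ns positiveSigns} {g = flower ns τ} iso positive-fixedPoint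
    with () ← trans (sym odd-parity) (fixedPoint-parity odd τ fixed)

oneNegatedSigns : ∀ {m} (ns : Vec ℕ (suc m)) → FlowerSigns ns
oneNegatedSigns {m} ns = record { centreSign = firstOnly ; petalSign = λ _ _ → false }
  where
  firstOnly : Fin (suc m) → Bool
  firstOnly zero = true
  firstOnly (suc _) = false

oneNegated-parity : ∀ {m} (ns : Vec ℕ (suc m)) → Flower.parity ns (oneNegatedSigns ns) ≡ true
oneNegated-parity {m} ns = cong₂ _xor_ (cong (true xor_) (bigXor-false m)) (Flower.positive-petals ns)

proposition2 : (m : ℕ) → 1 ≤ m → (ns : Vec ℕ m) → All (1 ≤_) ns →
    (m % 2 ≡ 0 →
       (σ τ : FlowerSigns ns) → BehIso (flower ns σ) (flower ns τ))
    × (m % 2 ≡ 1 →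
       Σ (FlowerSigns ns) λ σ₁ → Σ (FlowerSigns ns) λ σ₂ →
         ¬ BehIso (flower ns σ₁) (flower ns σ₂)
         × ((τ : FlowerSigns ns) →
              BehIso (flower ns τ) (flower ns σ₁) ⊎ BehIso (flower ns τ) (flower ns σ₂)))
proposition2 zero () ns _
proposition2 (suc m) _ ns _ = even-iso , λ odd →
  positiveSigns , oneNegatedSigns ns ,
  odd-parity-invariant odd (oneNegatedSigns ns) (oneNegated-parity ns) ,
  parity-dichotomy positiveSigns (oneNegatedSigns ns) positive-parity (oneNegated-parity ns)
  where open Flower ns
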